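{- Let $\mathcal{G}=(\mathcal{V},\mathcal{E})$ be a temporal graph (edges possibly associated with multiple time intervals) whose underlying graph has every node of degree at most $B$. Then the greedy algorithm described in the context outputs a 0-1 timed matching $M$ with $|M|\ge\frac{1}{2B-1}|M^{opt}|$ for every maximum 0-1 timed matching $M^{opt}$ of $\mathcal{G}$; in particular, for temporal graphs whose degree is bounded by a constant, it is a constant-factor approximation algorithm.
   Context: A temporal graph $\mathcal{G}=(\mathcal{V},\mathcal{E})$ with lifetime $\mathcal{T}$ has a finite node set and a finite edge set; each edge joins two distinct nodes (no self-loops, at most one edge per pair) and is associated with a nonempty list of time intervals $[s_1,f_1),\dots,[s_k,f_k)$ with integers $0\le s_1<f_1<s_2<\dots<s_k<f_k\le\mathcal{T}$, existing at each integer timestep in one of them. The underlying graph is the static graph on $\mathcal{V}$ with an edge $\{u,v\}$ per temporal edge between $u,v$. Two distinct edges overlap if they share an endpoint and exist at a common timestep. A 0-1 timed matching is a set of edges no two of which overlap; a maximum one has maximum cardinality. Greedy algorithm: let $E':=\mathcal{E}$, $M:=\emptyset$. While $E'\ne\emptyset$: choose $e\in E'$ whose number of overlapping edges within $E'$ is minimum (ties broken arbitrarily), add $e$ to $M$, and remove $e$ and all edges of $E'$ overlapping $e$ from $E'$. Output $M$. -}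

module Defs where

open import Data.Nat using (ℕ; zero; suc; _≤_; _<_)
open import Data.Fin using (Fin; _≟_)
open import Data.Fin.Subset using (Subset; _∈_; ⁅_⁆; _∪_; _─_; ⊥; ⊤; Empty; ∣_∣)
open import Data.List using (List; []; _∷_)
open import Data.List.Membership.Propositional using () renaming (_∈_ to _∈ˡ_)
open import Data.Product using (_×_; _,_; ∃; Σ)
open import Data.Sum using (_⊎_)
import Data.Unit
open import Data.Bool using (_∨_)
open import Data.Vec using (tabulate)
open import Relation.Nullary using (¬_; does)
open import Relation.Binary.PropositionalEquality using (_≡_; _≢_)

-- A time interval [s , f) is a pair (s , f) of naturals.
Interval : Set
Interval = ℕ × ℕ

WFIntervals : ℕ → ℕ → List Interval → Set
WFIntervals T lo [] = Data.Unit.⊤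
WFIntervals T lo ((s , f) ∷ rest) = lo ≤ s × s < f × f ≤ T × WFIntervals T (suc f) rest

record TEdge (n : ℕ) : Set where
  constructor tedge
  field
    end₁ : Fin n
    end₂ : Fin n
    intervals : List Interval
open TEdge public

record TemporalGraph (n m T : ℕ) : Set where
  field
    edge : Fin m → TEdge n
    noSelfLoop : ∀ i → end₁ (edge i) ≢ end₂ (edge i)
    nonemptyIntervals : ∀ i → intervals (edge i) ≢ []
    wfIntervals : ∀ i → WFIntervals T 0 (intervals (edge i))
    simple : ∀ i j → i ≢ j →
      ¬ ((end₁ (edge i) ≡ end₁ (edge j) × end₂ (edge i) ≡ end₂ (edge j))
         ⊎ (end₁ (edge i) ≡ end₂ (edge j) × end₂ (edge i) ≡ end₁ (edge j)))
open TemporalGraph public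

module _ {n m T : ℕ} (G : TemporalGraph n m T) where

  ExistsAt : Fin m → ℕ → Set
  ExistsAt i t = ∃ λ I → I ∈ˡ intervals (edge G i) × Data.Product.proj₁ I ≤ t × t < Data.Product.proj₂ I

  Incident : Fin n → Fin m → Set
  Incident v i = v ≡ end₁ (edge G i) ⊎ v ≡ end₂ (edge G i)

  Overlap : Fin m → Fin m → Set
  Overlap i j = i ≢ j × (∃ λ v → Incident v i × Incident v j) × (∃ λ t → ExistsAt i t × ExistsAt j t)

  IsMatching : Subset m → Set
  IsMatching M = ∀ i j → i ∈ M → j ∈ M → ¬ Overlap i j

  IsMaximumMatching : Subset m → Set
  IsMaximumMatching M = IsMatching M × (∀ M′ → IsMatching M′ → ∣ M′ ∣ ≤ ∣ M ∣)

  -- degree of v in the underlying static graph = number of incident edges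
  -- (one static edge per temporal edge)
  degree : Fin n → ℕ
  degree v = ∣ tabulate (λ i → does (v ≟ end₁ (edge G i)) ∨ does (v ≟ end₂ (edge G i))) ∣

  OverlapSetIn : Subset m → Fin m → Subset m → Set
  OverlapSetIn E′ i N = ∀ j → (j ∈ N → j ∈ E′ × Overlap i j) × (j ∈ E′ × Overlap i j → j ∈ N)

  -- Greedy E′ M : M is a possible output of the greedy algorithm started
  -- from the remaining edge set E′ (any tie-breaking).
  data Greedy : Subset m → Subset m → Set where
    done : ∀ {E′} → Empty E′ → Greedy E′ ⊥
    step : ∀ {E′ M} (i : Fin m) (Nᵢ : Subset m) →
      i ∈ E′ →
      OverlapSetIn E′ i Nᵢ →
      (∀ j Nⱼ → j ∈ E′ → OverlapSetIn E′ j Nⱼ → ∣ Nᵢ ∣ ≤ ∣ Nⱼ ∣) →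
      Greedy (E′ ─ (⁅ i ⁆ ∪ Nᵢ)) M →
      Greedy E′ (⁅ i ⁆ ∪ M)

  GreedyOutput : Subset m → Set
  GreedyOutput M = Greedy ⊤ M

module Submission where

open import Defs
open import Data.Nat using (ℕ; _≤_; _*_; _∸_)
open import Data.Fin using (Fin)
open import Data.Fin.Subset using (Subset; ∣_∣)
open import Data.Product using (_×_)

open import Data.Nat using (suc; _+_; _<_; z≤n; s≤s)
open import Data.Nat.Properties
  using ( ≤-trans; ≤-reflexive; n≤1+n; +-suc; +-comm; +-identityʳ; *-suc; +-mono-≤
        ; +-monoʳ-≤; +-monoʳ-<; *-monoʳ-≤; <⇒≤pred; pred[m∸n]≡m∸[1+n]; module ≤-Reasoning )
open import Data.Fin using (_≟_)
open import Data.Fin.Subset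
  using (_∈_; _∉_; _⊆_; ⁅_⁆; _∪_; _─_; _-_; inside; outside)
open import Data.Fin.Subset.Properties
  using ( p⊆q⇒∣p∣≤∣q∣; p⊂q⇒∣p∣<∣q∣; ⊆⊤; q⊆p∪q; x∈⁅x⁆; x∈⁅y⁆⇒x≡y; x∈p∪q⁻; x∈p∪q⁺
        ; p─q⊆p; x∈p∧x∉q⇒x∈p─q; x∈p∧x≢y⇒x∈p-y; x∈p⇒∣p-x∣<∣p∣; _∈?_; ∉⊥; Empty-unique; ∣⊥∣≡0 )
open import Data.Product using (_,_; proj₁; proj₂)
open import Data.Sum using (inj₁; inj₂)
open import Data.Bool using (true; _∨_)
open import Data.Vec using (_∷_; []; here; there; tabulate)
open import Data.Vec.Properties using (lookup⇒[]=; lookup∘tabulate)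
open import Data.Empty using (⊥-elim)
open import Relation.Nullary using (¬_; does; yes; no)
open import Relation.Binary.PropositionalEquality using (_≡_; refl; sym; trans; cong; subst)

-- Each greedy step selects an edge i and discards i together with the edges
-- overlapping it. All of these are incident to one of the two endpoints of i,
-- so at most 2B − 1 edges are discarded per selected edge, and every edge is
-- eventually discarded: |𝓔| ≤ (2B − 1)|M|. A maximum matching is a subset of
-- 𝓔.

∣p∪q∣≤∣p∣+∣q∣ : ∀ {k} (p q : Subset k) → ∣ p ∪ q ∣ ≤ ∣ p ∣ + ∣ q ∣
∣p∪q∣≤∣p∣+∣q∣ [] [] = z≤n
∣p∪q∣≤∣p∣+∣q∣ (outside ∷ p) (outside ∷ q) = ∣p∪q∣≤∣p∣+∣q∣ p q
∣p∪q∣≤∣p∣+∣q∣ (inside ∷ p) (outside ∷ q) = s≤s (∣p∪q∣≤∣p∣+∣q∣ p q)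
∣p∪q∣≤∣p∣+∣q∣ (outside ∷ p) (inside ∷ q) =
  ≤-trans (s≤s (∣p∪q∣≤∣p∣+∣q∣ p q)) (≤-reflexive (sym (+-suc ∣ p ∣ ∣ q ∣)))
∣p∪q∣≤∣p∣+∣q∣ (inside ∷ p) (inside ∷ q) =
  s≤s (≤-trans (∣p∪q∣≤∣p∣+∣q∣ p q) (+-monoʳ-≤ ∣ p ∣ (n≤1+n ∣ q ∣)))

x∈p─q⇒x∉q : ∀ {k} {x : Fin k} (p q : Subset k) → x ∈ p ─ q → x ∉ q
x∈p─q⇒x∉q (_ ∷ p) (outside ∷ q) here ()
x∈p─q⇒x∉q (_ ∷ p) (inside ∷ q) () here
x∈p─q⇒x∉q (_ ∷ p) (_ ∷ q) (there x∈p─q) (there x∈q) = x∈p─q⇒x∉q p q x∈p─q x∈q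

∣p∣≤∣p─q∣+∣q∣ : ∀ {k} (p q : Subset k) → ∣ p ∣ ≤ ∣ p ─ q ∣ + ∣ q ∣
∣p∣≤∣p─q∣+∣q∣ p q = ≤-trans (p⊆q⇒∣p∣≤∣q∣ p⊆[p─q]∪q) (∣p∪q∣≤∣p∣+∣q∣ (p ─ q) q)
  where
  p⊆[p─q]∪q : p ⊆ (p ─ q) ∪ q
  p⊆[p─q]∪q {x} x∈p with x ∈? q
  ... | yes x∈q = x∈p∪q⁺ (inj₂ x∈q)
  ... | no  x∉q = x∈p∪q⁺ (inj₁ (x∈p∧x∉q⇒x∈p─q x∈p x∉q))

x∉p⇒∣p∣<∣⁅x⁆∪p∣ : ∀ {k} (x : Fin k) (p : Subset k) → x ∉ p → ∣ p ∣ < ∣ ⁅ x ⁆ ∪ p ∣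
x∉p⇒∣p∣<∣⁅x⁆∪p∣ x p x∉p = p⊂q⇒∣p∣<∣q∣ (q⊆p∪q ⁅ x ⁆ p , x , x∈p∪q⁺ (inj₁ (x∈⁅x⁆ x)) , x∉p)

x∈q⇒∣p∪[q-x]∣<∣p∣+∣q∣ : ∀ {k} {x : Fin k} (p q : Subset k) → x ∈ q → ∣ p ∪ (q - x) ∣ < ∣ p ∣ + ∣ q ∣
x∈q⇒∣p∪[q-x]∣<∣p∣+∣q∣ p q x∈q = begin-strict
  ∣ p ∪ (q - _) ∣   ≤⟨ ∣p∪q∣≤∣p∣+∣q∣ p (q - _) ⟩
  ∣ p ∣ + ∣ q - _ ∣ <⟨ +-monoʳ-< ∣ p ∣ (x∈p⇒∣p-x∣<∣p∣ x∈q) ⟩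
  ∣ p ∣ + ∣ q ∣     ∎
  where open ≤-Reasoning

module _ {n m T : ℕ} (G : TemporalGraph n m T) where

  incidentEdges : Fin n → Subset m
  incidentEdges v = tabulate (λ i → does (v ≟ end₁ (edge G i)) ∨ does (v ≟ end₂ (edge G i)))

  Incident⇒∈incidentEdges : ∀ {v i} → Incident G v i → i ∈ incidentEdges v
  Incident⇒∈incidentEdges {v} {i} inc =
    lookup⇒[]= i (incidentEdges v) (trans (lookup∘tabulate _ i) (test inc))
    where
    test : Incident G v i → (does (v ≟ end₁ (edge G i)) ∨ does (v ≟ end₂ (edge G i))) ≡ true
    test (inj₁ v≡end₁) with v ≟ end₁ (edge G i)
    ... | yes _ = refl
    ... | no v≢end₁ = ⊥-elim (v≢end₁ v≡end₁)
    test (inj₂ v≡end₂) with v ≟ end₁ (edge G i) | v ≟ end₂ (edge G i)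
    ... | yes _ | _     = refl
    ... | no _  | yes _ = refl
    ... | no _  | no v≢end₂ = ⊥-elim (v≢end₂ v≡end₂)

  Overlap-sym : ∀ {i j} → Overlap G i j → Overlap G j i
  Overlap-sym (i≢j , (v , inc-i , inc-j) , (t , at-i , at-j)) =
    (λ j≡i → i≢j (sym j≡i)) , (v , inc-j , inc-i) , (t , at-j , at-i)

  ⁅i⁆∪overlaps⊆incidentEdges : ∀ {E′ i N} → OverlapSetIn G E′ i N →
    ⁅ i ⁆ ∪ N ⊆ incidentEdges (end₁ (edge G i)) ∪ (incidentEdges (end₂ (edge G i)) - i)
  ⁅i⁆∪overlaps⊆incidentEdges {i = i} {N} isOverlapSet {x} x∈ with x∈p∪q⁻ ⁅ i ⁆ N x∈
  ... | inj₁ x∈⁅i⁆ rewrite x∈⁅y⁆⇒x≡y i x∈⁅i⁆ =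
    x∈p∪q⁺ (inj₁ (Incident⇒∈incidentEdges (inj₁ refl)))
  ... | inj₂ x∈N with proj₁ (isOverlapSet x) x∈N
  ... | _ , i≢x , (_ , inj₁ refl , inc-x) , _ =
    x∈p∪q⁺ (inj₁ (Incident⇒∈incidentEdges inc-x))
  ... | _ , i≢x , (_ , inj₂ refl , inc-x) , _ =
    x∈p∪q⁺ (inj₂ (x∈p∧x≢y⇒x∈p-y (Incident⇒∈incidentEdges inc-x) (λ x≡i → i≢x (sym x≡i))))

  Greedy⇒⊆ : ∀ {E′ M} → Greedy G E′ M → M ⊆ E′
  Greedy⇒⊆ (done _) x∈⊥ = ⊥-elim (∉⊥ x∈⊥)
  Greedy⇒⊆ (step {E′} {M} i N i∈E′ _ _ run) x∈ with x∈p∪q⁻ ⁅ i ⁆ M x∈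
  ... | inj₁ x∈⁅i⁆ rewrite x∈⁅y⁆⇒x≡y i x∈⁅i⁆ = i∈E′
  ... | inj₂ x∈M = p─q⊆p E′ (⁅ i ⁆ ∪ N) (Greedy⇒⊆ run x∈M)

  Greedy⇒discarded∉ : ∀ {E′ R M} → Greedy G (E′ ─ R) M → ∀ {x} → x ∈ M → x ∉ R
  Greedy⇒discarded∉ {E′} {R} run x∈M = x∈p─q⇒x∉q E′ R (Greedy⇒⊆ run x∈M)

  Greedy⇒selected-overlaps-nothing : ∀ {E′ i N M} → OverlapSetIn G E′ i N →
    Greedy G (E′ ─ (⁅ i ⁆ ∪ N)) M → ∀ {k} → k ∈ M → ¬ Overlap G i k
  Greedy⇒selected-overlaps-nothing {E′} {i} {N} isOverlapSet run {k} k∈M i-overlaps-k =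
    Greedy⇒discarded∉ run k∈M (x∈p∪q⁺ (inj₂ (proj₂ (isOverlapSet k) (k∈E′ , i-overlaps-k))))
    where
    k∈E′ : k ∈ E′
    k∈E′ = p─q⊆p E′ (⁅ i ⁆ ∪ N) (Greedy⇒⊆ run k∈M)

  Greedy⇒IsMatching : ∀ {E′ M} → Greedy G E′ M → IsMatching G M
  Greedy⇒IsMatching (done _) a _ a∈⊥ = ⊥-elim (∉⊥ a∈⊥)
  Greedy⇒IsMatching (step {M = M} i _ _ isOverlapSet _ run) a b a∈ b∈
    with x∈p∪q⁻ ⁅ i ⁆ M a∈ | x∈p∪q⁻ ⁅ i ⁆ M b∈
  ... | inj₁ a∈⁅i⁆ | inj₁ b∈⁅i⁆ =
    λ (a≢b , _) → a≢b (trans (x∈⁅y⁆⇒x≡y i a∈⁅i⁆) (sym (x∈⁅y⁆⇒x≡y i b∈⁅i⁆)))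
  ... | inj₁ a∈⁅i⁆ | inj₂ b∈M rewrite x∈⁅y⁆⇒x≡y i a∈⁅i⁆ =
    Greedy⇒selected-overlaps-nothing isOverlapSet run b∈M
  ... | inj₂ a∈M | inj₁ b∈⁅i⁆ rewrite x∈⁅y⁆⇒x≡y i b∈⁅i⁆ =
    λ a-overlaps-i → Greedy⇒selected-overlaps-nothing isOverlapSet run a∈M (Overlap-sym a-overlaps-i)
  ... | inj₂ a∈M | inj₂ b∈M = Greedy⇒IsMatching run a b a∈M b∈M

  module _ (B : ℕ) (degree≤B : ∀ v → degree G v ≤ B) where

    ∣⁅i⁆∪overlaps∣≤2B∸1 : ∀ {E′ i N} → OverlapSetIn G E′ i N → ∣ ⁅ i ⁆ ∪ N ∣ ≤ 2 * B ∸ 1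
    ∣⁅i⁆∪overlaps∣≤2B∸1 {i = i} {N} isOverlapSet =
      subst (∣ ⁅ i ⁆ ∪ N ∣ ≤_) (pred[m∸n]≡m∸[1+n] (2 * B) 0) (<⇒≤pred (begin-strict
        ∣ ⁅ i ⁆ ∪ N ∣                          ≤⟨ p⊆q⇒∣p∣≤∣q∣ (⁅i⁆∪overlaps⊆incidentEdges isOverlapSet) ⟩
        ∣ incidentEdges v₁ ∪ (incidentEdges v₂ - i) ∣
          <⟨ x∈q⇒∣p∪[q-x]∣<∣p∣+∣q∣ (incidentEdges v₁) _ (Incident⇒∈incidentEdges (inj₂ refl)) ⟩
        degree G v₁ + degree G v₂              ≤⟨ +-mono-≤ (degree≤B v₁) (degree≤B v₂) ⟩
        B + B                                  ≡⟨ cong (B +_) (sym (+-identityʳ B)) ⟩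
        2 * B                                  ∎))
      where
      open ≤-Reasoning
      v₁ = end₁ (edge G i)
      v₂ = end₂ (edge G i)

    Greedy⇒∣E′∣≤[2B∸1]*∣M∣ : ∀ {E′ M} → Greedy G E′ M → ∣ E′ ∣ ≤ (2 * B ∸ 1) * ∣ M ∣
    Greedy⇒∣E′∣≤[2B∸1]*∣M∣ {E′} (done E′-empty) =
      ≤-trans (≤-reflexive (trans (cong ∣_∣ (Empty-unique E′-empty)) (∣⊥∣≡0 m))) z≤n
    Greedy⇒∣E′∣≤[2B∸1]*∣M∣ {E′} (step {M = M} i N _ isOverlapSet _ run) = begin
      ∣ E′ ∣                               ≤⟨ ∣p∣≤∣p─q∣+∣q∣ E′ (⁅ i ⁆ ∪ N) ⟩
      ∣ E′ ─ (⁅ i ⁆ ∪ N) ∣ + ∣ ⁅ i ⁆ ∪ N ∣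
        ≤⟨ +-mono-≤ (Greedy⇒∣E′∣≤[2B∸1]*∣M∣ run) (∣⁅i⁆∪overlaps∣≤2B∸1 isOverlapSet) ⟩
      K * ∣ M ∣ + K                        ≡⟨ +-comm (K * ∣ M ∣) K ⟩
      K + K * ∣ M ∣                        ≡⟨ sym (*-suc K ∣ M ∣) ⟩
      K * suc ∣ M ∣                        ≤⟨ *-monoʳ-≤ K (x∉p⇒∣p∣<∣⁅x⁆∪p∣ i M i∉M) ⟩
      K * ∣ ⁅ i ⁆ ∪ M ∣                    ∎
      where
      open ≤-Reasoning
      K = 2 * B ∸ 1
      i∉M : i ∉ M
      i∉M i∈M = Greedy⇒discarded∉ run i∈M (x∈p∪q⁺ (inj₁ (x∈⁅x⁆ i)))

corollary4 : ∀ {n m T : ℕ} (G : TemporalGraph n m T) (B : ℕ) →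
    (∀ (v : Fin n) → degree G v ≤ B) →
    ∀ (M : Subset m) → GreedyOutput G M →
    IsMatching G M × (∀ (Mopt : Subset m) → IsMaximumMatching G Mopt → ∣ Mopt ∣ ≤ (2 * B ∸ 1) * ∣ M ∣)
corollary4 G B degree≤B M run =
  Greedy⇒IsMatching G run ,
  λ Mopt _ → ≤-trans (p⊆q⇒∣p∣≤∣q∣ {p = Mopt} ⊆⊤) (Greedy⇒∣E′∣≤[2B∸1]*∣M∣ G B degree≤B run)
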